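{- Let $A$ be an ASM. If $A$ has a $-1$ strictly southwest of another $-1$ (i.e. entries $A_{i,j}=A_{i',j'}=-1$ with $i>i'$ and $j<j'$), then $A$ classically contains $3412$. If $A$ has a $-1$ strictly northwest of another $-1$ (i.e. $A_{i,j}=A_{i',j'}=-1$ with $i<i'$ and $j<j'$), then $A$ classically contains $2143$.
   Context: An alternating sign matrix (ASM) is a square matrix with entries in $\{0,1,-1\}$ such that every row and every column sums to $1$ and the nonzero entries of each row and each column alternate in sign. Row indices increase going south, column indices increase going east. A permutation $\pi\in S_k$ is identified with the $k\times k$ matrix whose row $i$ has a $1$ in column $\pi(i)$ and $0$ elsewhere. An $n\times n$ ASM $A$ classically contains $\pi\in S_k$ if there are order-preserving injections $f,g:[k]\to[n]$ with $A_{f(i),g(\pi(i))}=1$ for all $i$. -}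

module Defs where

open import Data.Nat using (ℕ)
open import Data.Fin using (Fin; zero; suc; _<_)
open import Data.Integer using (ℤ; +_; -[1+_])
open import Data.Fin.Properties using ()
open import Data.Product using (Σ; _×_; ∃)
open import Data.Sum using (_⊎_)
open import Relation.Binary.PropositionalEquality using (_≡_; _≢_)
open import Relation.Nullary using (¬_)
open import Data.Vec.Functional using (Vector)
open import Data.Vec.Functional using () renaming (foldr to vfoldr)
import Data.Integer as ℤ

-- An n×n matrix with integer entries: row index first, column index second.
Matrix : ℕ → Set
Matrix n = Fin n → Fin n → ℤ

sumℤ : ∀ {n} → (Fin n → ℤ) → ℤ
sumℤ v = vfoldr ℤ._+_ (+ 0) v

-1ℤ : ℤ
-1ℤ = -[1+ 0 ]

IsSignEntry : ℤ → Set
IsSignEntry x = (x ≡ + 0) ⊎ (x ≡ + 1) ⊎ (x ≡ -1ℤ)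

Alternates : ∀ {n} → (Fin n → ℤ) → Set
Alternates {n} v =
  ∀ (j j' : Fin n) → j < j' → v j ≢ + 0 → v j' ≢ + 0 →
  (∀ (m : Fin n) → j < m → m < j' → v m ≡ + 0) →
  v j ≢ v j'

record IsASM {n : ℕ} (A : Matrix n) : Set where
  field
    entries  : ∀ i j → IsSignEntry (A i j)
    rowSum   : ∀ i → sumℤ (λ j → A i j) ≡ + 1
    colSum   : ∀ j → sumℤ (λ i → A i j) ≡ + 1
    rowAlt   : ∀ i → Alternates (λ j → A i j)
    colAlt   : ∀ j → Alternates (λ i → A i j)

OrderPreserving : ∀ {k n} → (Fin k → Fin n) → Set
OrderPreserving {k} f = ∀ (a b : Fin k) → a < b → f a < f b

ClassicallyContains : ∀ {n k} → Matrix n → (Fin k → Fin k) → Set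
ClassicallyContains {n} {k} A π =
  Σ (Fin k → Fin n) λ f → Σ (Fin k → Fin n) λ g →
    OrderPreserving f × OrderPreserving g × (∀ i → A (f i) (g (π i)) ≡ + 1)

-- The permutations 3412 and 2143 in S_4, one-line notation, 0-indexed.
p3412 : Fin 4 → Fin 4
p3412 zero = suc (suc zero)
p3412 (suc zero) = suc (suc (suc zero))
p3412 (suc (suc zero)) = zero
p3412 (suc (suc (suc zero))) = suc zero

p2143 : Fin 4 → Fin 4
p2143 zero = suc zero
p2143 (suc zero) = zero
p2143 (suc (suc zero)) = suc (suc (suc zero))
p2143 (suc (suc (suc zero))) = suc (suc zero)

-- In a vector with entries in {0, 1, -1} whose nonzero entries alternate, the sum
-- is the first nonzero entry when there is an odd number of them and 0 otherwise,
-- and the last nonzero entry equals the first, resp. its negative.  Every row and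
-- column of an ASM sums to 1, so its first and last nonzero entries are 1: each -1
-- has a 1 to its north, south, west and east.  For two -1's in southwest/northeast
-- (resp. northwest/southeast) position, the 1 north and the 1 east of the upper
-- one and the 1 west and the 1 south of the lower one form a 3412 (resp. 2143).
module Submission where

open import Defs
open import Data.Nat using (ℕ; zero; suc; s≤s; z≤n)
open import Data.Fin using (Fin; _<_; zero; suc)
open import Data.Fin.Properties using (<-cmp; <-trans; all?; ¬∀⟶∃¬)
open import Data.Integer using (ℤ; +_; -_; _+_; _≟_)
open import Data.Integer.Properties using (+-identityˡ; +-identityʳ; +-inverseʳ; neg-involutive)
open import Data.Product using (_×_; _,_; ∃)
open import Data.Sum using (_⊎_; inj₁; inj₂)
open import Data.Vec.Functional using (Vector; tail; _∷_; [])
open import Relation.Binary using (tri<; tri≈; tri>)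
open import Relation.Binary.PropositionalEquality using (_≡_; _≢_; refl; sym; trans; cong)
open import Relation.Nullary using (yes; no; contradiction)

private
  variable
    n : ℕ

SignVector : Vector ℤ n → Set
SignVector v = ∀ j → IsSignEntry (v j)

FirstNonzero : Vector ℤ n → Fin n → Set
FirstNonzero v k = v k ≢ + 0 × (∀ m → m < k → v m ≡ + 0)

LastNonzero : Vector ℤ n → Fin n → Set
LastNonzero v k = v k ≢ + 0 × (∀ m → k < m → v m ≡ + 0)

firstNonzero : (v : Vector ℤ n) (p : Fin n) → v p ≢ + 0 → ∃ (FirstNonzero v)
firstNonzero {suc n} v p vp≢0 with v zero ≟ + 0
... | no v₀≢0 = zero , v₀≢0 , λ m ()
firstNonzero {suc n} v zero v₀≢0 | yes v₀≡0 = contradiction v₀≡0 v₀≢0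
firstNonzero {suc n} v (suc p) vp≢0 | yes v₀≡0 with firstNonzero (tail v) p vp≢0
... | k , vk≢0 , before = suc k , vk≢0 , before′
  where
  before′ : ∀ m → m < suc k → v m ≡ + 0
  before′ zero    _         = v₀≡0
  before′ (suc m) (s≤s m<k) = before m m<k

lastNonzero : (v : Vector ℤ n) (p : Fin n) → v p ≢ + 0 → ∃ (LastNonzero v)
lastNonzero {suc n} v p vp≢0 with all? (λ m → tail v m ≟ + 0)
... | no tail≢0 with ¬∀⟶∃¬ n _ (λ m → tail v m ≟ + 0) tail≢0
...   | q , vq≢0 with lastNonzero (tail v) q vq≢0
...     | l , vl≢0 , after = suc l , vl≢0 , λ { (suc m) (s≤s l<m) → after m l<m }
lastNonzero {suc n} v zero v₀≢0 | yes tail≡0 = zero , v₀≢0 , λ { (suc m) _ → tail≡0 m }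
lastNonzero {suc n} v (suc p) vp≢0 | yes tail≡0 = contradiction (tail≡0 p) vp≢0

first<nonzero : ∀ {v : Vector ℤ n} {f k} → FirstNonzero v f →
                v k ≢ + 0 → v f ≢ v k → f < k
first<nonzero {f = f} {k} (_ , before) vk≢0 vf≢vk with <-cmp f k
... | tri< f<k _ _ = f<k
... | tri≈ _ refl _ = contradiction refl vf≢vk
... | tri> _ _ k<f = contradiction (before k k<f) vk≢0

nonzero<last : ∀ {v : Vector ℤ n} {l k} → LastNonzero v l →
               v k ≢ + 0 → v l ≢ v k → k < l
nonzero<last {l = l} {k} (_ , after) vk≢0 vl≢vk with <-cmp k l
... | tri< k<l _ _ = k<l
... | tri≈ _ refl _ = contradiction refl vl≢vk
... | tri> _ _ l<k = contradiction (after k l<k) vk≢0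

sumℤ-zero : (v : Vector ℤ n) → (∀ m → v m ≡ + 0) → sumℤ v ≡ + 0
sumℤ-zero {zero}  v v≡0 = refl
sumℤ-zero {suc n} v v≡0 rewrite v≡0 zero | sumℤ-zero (tail v) (λ m → v≡0 (suc m)) = refl

alternates-tail : (v : Vector ℤ (suc n)) → Alternates v → Alternates (tail v)
alternates-tail v alt j j′ j<j′ vj≢0 vj′≢0 between =
  alt (suc j) (suc j′) (s≤s j<j′) vj≢0 vj′≢0 λ { (suc m) (s≤s j<m) (s≤s m<j′) → between m j<m m<j′ }

distinct-signs-opposite : ∀ {x y} → IsSignEntry x → IsSignEntry y →
                          x ≢ + 0 → y ≢ + 0 → x ≢ y → y ≡ - x
distinct-signs-opposite (inj₁ refl)        _                  x≢0 _   _   = contradiction refl x≢0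
distinct-signs-opposite _                  (inj₁ refl)        _   y≢0 _   = contradiction refl y≢0
distinct-signs-opposite (inj₂ (inj₁ refl)) (inj₂ (inj₁ refl)) _   _   x≢y = contradiction refl x≢y
distinct-signs-opposite (inj₂ (inj₁ refl)) (inj₂ (inj₂ refl)) _   _   _   = refl
distinct-signs-opposite (inj₂ (inj₂ refl)) (inj₂ (inj₁ refl)) _   _   _   = refl
distinct-signs-opposite (inj₂ (inj₂ refl)) (inj₂ (inj₂ refl)) _   _   x≢y = contradiction refl x≢y

AlternatingSum : ℤ → ℤ → ℤ → Set
AlternatingSum x s y = (s ≡ x × y ≡ x) ⊎ (s ≡ + 0 × y ≡ - x)

AlternatingSum-cons : ∀ x {x′ s y} → x′ ≡ - x → AlternatingSum x′ s y → AlternatingSum x (x + s) y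
AlternatingSum-cons x refl (inj₁ (s≡-x , y≡-x)) =
  inj₂ (trans (cong (λ t → x + t) s≡-x) (+-inverseʳ x) , y≡-x)
AlternatingSum-cons x refl (inj₂ (s≡0 , y≡--x)) =
  inj₁ (trans (cong (λ t → x + t) s≡0) (+-identityʳ x) , trans y≡--x (neg-involutive x))

alternating-sum : (v : Vector ℤ n) → SignVector v → Alternates v →
                  ∀ {f l} → FirstNonzero v f → LastNonzero v l →
                  AlternatingSum (v f) (sumℤ v) (v l)
alternating-sum {suc n} v signs alt {zero} {zero} _ (_ , after)
  rewrite sumℤ-zero (tail v) (λ m → after (suc m) (s≤s z≤n)) = inj₁ (+-identityʳ (v zero) , refl)
alternating-sum {suc n} v signs alt {suc f} {zero} (vf≢0 , _) (_ , after) =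
  contradiction (after (suc f) (s≤s z≤n)) vf≢0
alternating-sum {suc n} v signs alt {suc f} {suc l} (vf≢0 , before) (vl≢0 , after)
  rewrite before zero (s≤s z≤n) | +-identityˡ (sumℤ (tail v)) =
  alternating-sum (tail v) (λ m → signs (suc m)) (alternates-tail v alt)
    (vf≢0 , λ m m<f → before (suc m) (s≤s m<f)) (vl≢0 , λ m l<m → after (suc m) (s≤s l<m))
alternating-sum {suc n} v signs alt {zero} {suc l} (v₀≢0 , _) (vl≢0 , after)
  with firstNonzero (tail v) l vl≢0
... | k , vk≢0 , before = AlternatingSum-cons (v zero) vk≡-v₀ tail-sum
  where
  tail-sum : AlternatingSum (v (suc k)) (sumℤ (tail v)) (v (suc l))
  tail-sum = alternating-sum (tail v) (λ m → signs (suc m)) (alternates-tail v alt)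
               (vk≢0 , before) (vl≢0 , λ m l<m → after (suc m) (s≤s l<m))
  vk≡-v₀ : v (suc k) ≡ - v zero
  vk≡-v₀ = distinct-signs-opposite (signs zero) (signs (suc k)) v₀≢0 vk≢0
             (alt zero (suc k) (s≤s z≤n) v₀≢0 vk≢0 λ { (suc m) _ (s≤s m<k) → before m m<k })

record FlankedByOnes (v : Vector ℤ n) (k : Fin n) : Set where
  constructor flankedByOnes
  field
    before   : Fin n
    before<k : before < k
    v-before : v before ≡ + 1
    after    : Fin n
    k<after  : k < after
    v-after  : v after ≡ + 1

minusOne≢zero : ∀ {x} → x ≡ -1ℤ → x ≢ + 0
minusOne≢zero refl ()

one≢minusOne : ∀ {x y} → x ≡ + 1 → y ≡ -1ℤ → x ≢ y
one≢minusOne refl refl ()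

sum≡1⇒ends≡1 : (v : Vector ℤ n) → SignVector v → Alternates v → sumℤ v ≡ + 1 →
               ∀ {f l} → FirstNonzero v f → LastNonzero v l → v f ≡ + 1 × v l ≡ + 1
sum≡1⇒ends≡1 v signs alt sum≡1 {f} first last with alternating-sum v signs alt first last
... | inj₁ (sum≡vf , vl≡vf) = vf≡1 , trans vl≡vf vf≡1
  where
  vf≡1 : v f ≡ + 1
  vf≡1 = trans (sym sum≡vf) sum≡1
... | inj₂ (sum≡0 , _) with trans (sym sum≡1) sum≡0
...   | ()

minusOne-flankedByOnes : (v : Vector ℤ n) → SignVector v → Alternates v → sumℤ v ≡ + 1 →
                         ∀ {k} → v k ≡ -1ℤ → FlankedByOnes v k
minusOne-flankedByOnes v signs alt sum≡1 {k} vk≡-1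
  with firstNonzero v k (minusOne≢zero vk≡-1) | lastNonzero v k (minusOne≢zero vk≡-1)
... | f , first | l , last with sum≡1⇒ends≡1 v signs alt sum≡1 first last
...   | vf≡1 , vl≡1 = flankedByOnes
  f (first<nonzero first (minusOne≢zero vk≡-1) (one≢minusOne vf≡1 vk≡-1)) vf≡1
  l (nonzero<last last (minusOne≢zero vk≡-1) (one≢minusOne vl≡1 vk≡-1)) vl≡1

module _ {A : Matrix n} (asm : IsASM A) where
  open IsASM asm

  row-flankedByOnes : ∀ {i j} → A i j ≡ -1ℤ → FlankedByOnes (λ j → A i j) j
  row-flankedByOnes {i} = minusOne-flankedByOnes _ (entries i) (rowAlt i) (rowSum i)

  column-flankedByOnes : ∀ {i j} → A i j ≡ -1ℤ → FlankedByOnes (λ i → A i j) i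
  column-flankedByOnes {j = j} = minusOne-flankedByOnes _ (λ i → entries i j) (colAlt j) (colSum j)

∷-orderPreserving : ∀ {k} {a : Fin n} {f : Fin (suc k) → Fin n} →
                    a < f zero → OrderPreserving f → OrderPreserving (a ∷ f)
∷-orderPreserving a<f₀ f↑ zero    zero          ()
∷-orderPreserving a<f₀ f↑ (suc a) zero          ()
∷-orderPreserving a<f₀ f↑ zero    (suc zero)    _ = a<f₀
∷-orderPreserving a<f₀ f↑ zero    (suc (suc b)) _ = <-trans a<f₀ (f↑ zero (suc b) (s≤s z≤n))
∷-orderPreserving a<f₀ f↑ (suc a) (suc b) (s≤s a<b) = f↑ a b a<b

increasing4 : ∀ {a b c d : Fin n} → a < b → b < c → c < d → OrderPreserving (a ∷ b ∷ c ∷ d ∷ [])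
increasing4 a<b b<c c<d =
  ∷-orderPreserving a<b (∷-orderPreserving b<c (∷-orderPreserving c<d λ { zero zero () ; _ (suc ()) _ }))

southwest-minusOnes⇒3412 : ∀ {A : Matrix n} → IsASM A → ∀ {i j i′ j′} →
                           A i j ≡ -1ℤ → A i′ j′ ≡ -1ℤ → i′ < i → j < j′ →
                           ClassicallyContains A p3412
southwest-minusOnes⇒3412 asm e e′ i′<i j<j′
  with column-flankedByOnes asm e′ | row-flankedByOnes asm e′
     | row-flankedByOnes asm e     | column-flankedByOnes asm e
... | flankedByOnes a a<i′ Aa _ _ _ | flankedByOnes _ _ _ b j′<b Ab
    | flankedByOnes c c<j Ac _ _ _  | flankedByOnes _ _ _ d i<d Ad =
  (a ∷ _ ∷ _ ∷ d ∷ []) , (c ∷ _ ∷ _ ∷ b ∷ []) ,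
  increasing4 a<i′ i′<i i<d , increasing4 c<j j<j′ j′<b ,
  λ { zero → Aa ; (suc zero) → Ab ; (suc (suc zero)) → Ac ; (suc (suc (suc zero))) → Ad }

northwest-minusOnes⇒2143 : ∀ {A : Matrix n} → IsASM A → ∀ {i j i′ j′} →
                           A i j ≡ -1ℤ → A i′ j′ ≡ -1ℤ → i < i′ → j < j′ →
                           ClassicallyContains A p2143
northwest-minusOnes⇒2143 asm e e′ i<i′ j<j′
  with column-flankedByOnes asm e | row-flankedByOnes asm e
     | row-flankedByOnes asm e′   | column-flankedByOnes asm e′
... | flankedByOnes a a<i Aa _ _ _ | flankedByOnes c c<j Ac _ _ _
    | flankedByOnes _ _ _ b j′<b Ab | flankedByOnes _ _ _ d i′<d Ad =
  (a ∷ _ ∷ _ ∷ d ∷ []) , (c ∷ _ ∷ _ ∷ b ∷ []) ,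
  increasing4 a<i i<i′ i′<d , increasing4 c<j j<j′ j′<b ,
  λ { zero → Aa ; (suc zero) → Ac ; (suc (suc zero)) → Ab ; (suc (suc (suc zero))) → Ad }

lemma4p1 : ∀ (n : ℕ) (A : Matrix n) → IsASM A →
    (∀ (i j i' j' : Fin n) → A i j ≡ -1ℤ → A i' j' ≡ -1ℤ → i' < i → j < j' →
      ClassicallyContains A p3412)
    × (∀ (i j i' j' : Fin n) → A i j ≡ -1ℤ → A i' j' ≡ -1ℤ → i < i' → j < j' →
      ClassicallyContains A p2143)
lemma4p1 n A asm =
  (λ i j i′ j′ → southwest-minusOnes⇒3412 asm) ,
  (λ i j i′ j′ → northwest-minusOnes⇒2143 asm)
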